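{- Let $k,p$ be positive integers, let $G$ be a finite multigraph, and let $A_1,\ldots,A_p$ be subsets of $p$ distinct equivalence classes of the relation $\sim_k$ on $V(G)$ (the subset $A_i$ lying in the $i$-th class). Then there is an edge set $X\subseteq E(G)$ of size at most $(p-1)(k-1)$ such that for all distinct $i,j\in\{1,\ldots,p\}$ the multigraph $G-X$ contains no $A_i$--$A_j$-path.
   Context: For vertices $u,v$ of $G$, $u\sim_k v$ holds if either $u=v$ or there are $k$ edge-disjoint $u$--$v$-paths in $G$; this is an equivalence relation on $V(G)$. $G-X$ denotes $G$ with the edges of $X$ deleted. For vertex sets $A,B$, an $A$--$B$-path is a path with one endpoint in $A$ and one in $B$ that is internally disjoint from $A\cup B$. -}

module Defs where

open import Data.Nat using (ℕ)
open import Data.Fin using (Fin)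
open import Data.Fin.Subset using (Subset; _∈_; _∉_)
open import Data.Product using (_×_; _,_; Σ-syntax)
open import Data.Sum using (_⊎_)
open import Data.List using (List; []; _∷_)
open import Data.List.Relation.Unary.All using (All)
open import Data.List.Relation.Unary.Unique.Propositional using (Unique)
import Data.List.Membership.Propositional as LMem
open import Relation.Binary.PropositionalEquality using (_≡_; _≢_)
open import Relation.Nullary using (¬_)

-- A finite multigraph: vertices Fin n, edges Fin m, each edge with its
-- (unordered) pair of endpoints given by `ends` (parallel edges allowed).
record Multigraph : Set where
  field
    n    : ℕ
    m    : ℕ
    ends : Fin m → Fin n × Fin n

module _ (G : Multigraph) where
  open Multigraph G

  V : Set
  V = Fin n

  E : Set
  E = Fin m

  Joins : E → V → V → Set
  Joins e u w = ends e ≡ (u , w) ⊎ ends e ≡ (w , u)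

  data Walk : V → V → Set where
    []   : ∀ {v} → Walk v v
    step : ∀ {u w v} (e : E) → Joins e u w → Walk w v → Walk u v

  verts : ∀ {u v} → Walk u v → List V
  verts {u} []           = u ∷ []
  verts {u} (step e j W) = u ∷ verts W

  edges : ∀ {u v} → Walk u v → List E
  edges []           = []
  edges (step e j W) = e ∷ edges W

  inner : ∀ {u v} → Walk u v → List V
  inner []                         = []
  inner (step e j [])              = []
  inner (step {w = w} e j (step e' j' W)) = w ∷ inner (step e' j' W)

  IsPath : ∀ {u v} → Walk u v → Set
  IsPath W = Unique (verts W)

  record Path (u v : V) : Set where
    constructor path
    field
      walk   : Walk u v
      isPath : IsPath walk

  open Path public

  EdgeDisjointPaths : ℕ → V → V → Set
  EdgeDisjointPaths k u v =
    Σ[ P ∈ (Fin k → Path u v) ]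
      (∀ i j → i ≢ j → ∀ e → e LMem.∈ edges (walk (P i)) → ¬ (e LMem.∈ edges (walk (P j))))

  _∼[_]_ : V → ℕ → V → Set
  u ∼[ k ] v = u ≡ v ⊎ EdgeDisjointPaths k u v

  -- a path in G - X : a path of G using no edge of X
  PathAvoiding : Subset m → ∀ {u v} → Path u v → Set
  PathAvoiding X P = All (λ e → e ∉ X) (edges (walk P))

  IsABPath : Subset n → Subset n → ∀ {u v} → Path u v → Set
  IsABPath A B {u} {v} P =
    u ∈ A × v ∈ B × All (λ x → x ∉ A × x ∉ B) (inner (walk P))

  HasABPathIn- : Subset m → Subset n → Subset n → Set
  HasABPathIn- X A B =
    Σ[ u ∈ V ] Σ[ v ∈ V ] Σ[ P ∈ Path u v ] (IsABPath A B P × PathAvoiding X P)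

module Submission where

-- Edge-Menger, by augmenting paths: given j edge-disjoint s–t paths, either the residual graph (free
-- edges, and path edges traversed backwards) has an s–t path, which is exchanged against the paths until
-- it uses free edges only and can be added as a (j+1)-st path, or the set S of vertices residually
-- reachable from s has at most j boundary edges, because each path leaves S exactly once.
-- So two distinct ∼_k-classes are separated by a vertex set S with |∂S| < k, and no ∼_k-class meets both
-- S and its complement. Splitting the p classes recursively by such sets gives a binary tree with p leaves,
-- hence p − 1 boundaries of at most k − 1 edges each, and an A_i–A_j path has to cross the boundary that
-- split i from j.

open import Defs
open import Data.Bool using (Bool; true; false; _xor_)
open import Data.Bool.Properties using (not-¬) renaming (_≟_ to _≟ᵇ_)
open import Data.Empty using (⊥-elim)
open import Data.Fin using (Fin; zero; suc) renaming (_≟_ to _≟ᶠ_)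
open import Data.Fin.Properties using (injective⇒≤; suc-injective; all?; any?)
open import Data.Fin.Subset using (Subset; inside; outside; ∣_∣; _∪_; ⁅_⁆; ⊥; _⊂_; _⊃_)
  renaming (_∈_ to _∈ˢ_; _⊆_ to _⊆ˢ_)
open import Data.Fin.Subset.Properties
  using (x∈p∪q⁺; x∈p∪q⁻; p⊆p∪q; q⊆p∪q; x∈⁅x⁆; x∈⁅y⁆⇒x≡y; ∣⊥∣≡0)
  renaming (_∈?_ to _∈ˢ?_)
open import Data.Fin.Subset.Induction using (⊃-wellFounded)
open import Data.List using (List; []; _∷_; _++_; map; length; filter; allFin)
open import Data.List.Properties
  using (filter-++; length-++; filter-none; filter-accept; filter-some; filter-notAll; length-tabulate)
open import Data.List.Membership.Propositional using (_∈_; _∉_)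
open import Data.List.Membership.Propositional.Properties
  using (∈-++⁺ˡ; ∈-++⁺ʳ; ∈-++⁻; ∈-map⁺; ∈-map⁻; ∈-filter⁺; ∈-allFin)
open import Data.List.Relation.Unary.All using (All; []; _∷_)
import Data.List.Relation.Unary.All as All
open import Data.List.Relation.Unary.All.Properties using (¬Any⇒All¬; ++⁺)
open import Data.List.Relation.Unary.AllPairs using (AllPairs; []; _∷_)
open import Data.List.Relation.Unary.Any using (Any; here; there)
open import Data.List.Relation.Unary.Unique.Propositional using (Unique)
import Data.List.Relation.Unary.Unique.Propositional.Properties as Unique
open import Data.List.Relation.Binary.Sublist.Propositional using (_⊆_; []; _∷_; _∷ʳ_; ⊆-refl; ⊆-trans)
import Data.List.Relation.Binary.Sublist.Propositional as Sublist
open import Data.List.Relation.Binary.Sublist.Propositional.Properties using (All-resp-⊆; length-mono-≤; filter⁺)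
open import Data.Nat using (ℕ; zero; suc; _+_; _*_; _∸_; _≤_; _<_; z≤n; s≤s)
open import Data.Nat.Induction using (<-wellFounded)
open import Data.Nat.Properties
  using (≤-refl; ≤-reflexive; ≤-trans; ≤-pred; n<1+n; <-≤-trans; <⇒≱; n≮0; +-suc; +-mono-≤; +-assoc; +-comm;
         *-distribʳ-+; m≤n⇒m≤1+n; m<n⇒m<1+n; suc[m]≤n⇒m≤pred[n]; module ≤-Reasoning)
open import Data.Product using (Σ-syntax; _×_; _,_; proj₁; proj₂)
open import Data.Product.Properties using (≡-dec; ,-injectiveˡ; ,-injectiveʳ)
open import Data.Sum using (_⊎_; inj₁; inj₂)
open import Data.Vec using ([]; _∷_; lookup; tabulate)
open import Data.Vec.Base using () renaming (here to here[]; there to there[])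
open import Data.Vec.Properties using ([]=⇒lookup; lookup⇒[]=; lookup∘tabulate)
open import Function using (_∘_; id; case_of_; _⇔_; mk⇔; Equivalence)
open import Induction.WellFounded using (Acc; acc)
open import Relation.Binary using (Rel) renaming (Decidable to Decidable₂)
open import Relation.Binary.Construct.Closure.ReflexiveTransitive using (Star; ε; _◅_; _◅◅_)
open import Relation.Binary.Definitions using (DecidableEquality)
open import Relation.Binary.PropositionalEquality
open import Relation.Nullary using (¬_; Dec; yes; no)
open import Relation.Nullary.Decidable using (¬?; _×-dec_; _⊎-dec_)
open import Relation.Unary using (Pred; Decidable)
open import Relation.Unary.Properties using (∁?)

-- Cardinality of finite subsets

member : ∀ {n} (p : Subset n) → Fin ∣ p ∣ → Fin n
member (outside ∷ p) i       = suc (member p i)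
member (inside  ∷ p) zero    = zero
member (inside  ∷ p) (suc i) = suc (member p i)

member-∈ : ∀ {n} (p : Subset n) (i : Fin ∣ p ∣) → member p i ∈ˢ p
member-∈ (outside ∷ p) i       = there[] (member-∈ p i)
member-∈ (inside  ∷ p) zero    = here[]
member-∈ (inside  ∷ p) (suc i) = there[] (member-∈ p i)

member-injective : ∀ {n} (p : Subset n) {i j} → member p i ≡ member p j → i ≡ j
member-injective (outside ∷ p) eq = member-injective p (suc-injective eq)
member-injective (inside ∷ p) {zero}  {zero}  eq = refl
member-injective (inside ∷ p) {suc i} {suc j} eq = cong suc (member-injective p (suc-injective eq))

position : ∀ {n} (p : Subset n) {x} → x ∈ˢ p → Fin ∣ p ∣
position (inside  ∷ p) here[]      = zero
position (outside ∷ p) (there[] q) = position p q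
position (inside  ∷ p) (there[] q) = suc (position p q)

position-injective : ∀ {n} (p : Subset n) {x y} (x∈p : x ∈ˢ p) (y∈p : y ∈ˢ p) →
                     position p x∈p ≡ position p y∈p → x ≡ y
position-injective (inside  ∷ p) here[]      here[]      eq = refl
position-injective (outside ∷ p) (there[] a) (there[] b) eq = cong suc (position-injective p a b eq)
position-injective (inside  ∷ p) (there[] a) (there[] b) eq =
  cong suc (position-injective p a b (suc-injective eq))

injective-into⇒≤∣p∣ : ∀ {k n} (p : Subset n) (f : Fin k → Fin n) → (∀ {i j} → f i ≡ f j → i ≡ j) →
                      (∀ i → f i ∈ˢ p) → k ≤ ∣ p ∣
injective-into⇒≤∣p∣ p f f-inj f∈p =
  injective⇒≤ (λ {i} {j} eq → f-inj (position-injective p (f∈p i) (f∈p j) eq))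

injective-from⇒∣p∣≤ : ∀ {k n} (p : Subset n) (g : ∀ {x} → x ∈ˢ p → Fin k) →
                      (∀ {x y} (x∈p : x ∈ˢ p) (y∈p : y ∈ˢ p) → g x∈p ≡ g y∈p → x ≡ y) → ∣ p ∣ ≤ k
injective-from⇒∣p∣≤ p g g-inj =
  injective⇒≤ (λ {i} {j} eq → member-injective p (g-inj (member-∈ p i) (member-∈ p j) eq))

∣p∪q∣≤∣p∣+∣q∣ : ∀ {n} (p q : Subset n) → ∣ p ∪ q ∣ ≤ ∣ p ∣ + ∣ q ∣
∣p∪q∣≤∣p∣+∣q∣ []            []            = z≤n
∣p∪q∣≤∣p∣+∣q∣ (outside ∷ p) (outside ∷ q) = ∣p∪q∣≤∣p∣+∣q∣ p q
∣p∪q∣≤∣p∣+∣q∣ (outside ∷ p) (inside  ∷ q) =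
  ≤-trans (s≤s (∣p∪q∣≤∣p∣+∣q∣ p q)) (≤-reflexive (sym (+-suc ∣ p ∣ ∣ q ∣)))
∣p∪q∣≤∣p∣+∣q∣ (inside  ∷ p) (outside ∷ q) = s≤s (∣p∪q∣≤∣p∣+∣q∣ p q)
∣p∪q∣≤∣p∣+∣q∣ (inside  ∷ p) (inside  ∷ q) =
  s≤s (≤-trans (m≤n⇒m≤1+n (∣p∪q∣≤∣p∣+∣q∣ p q)) (≤-reflexive (sym (+-suc ∣ p ∣ ∣ q ∣))))

module _ {a p q} {A : Set a} {P : Pred A p} {Q : Pred A q} (P? : Decidable P) (Q? : Decidable Q) where

  length-filter-mono : ∀ {xs} → All (λ x → P x → Q x) xs → length (filter P? xs) ≤ length (filter Q? xs)
  length-filter-mono {[]}     []           = z≤n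
  length-filter-mono {x ∷ xs} (P⇒Q ∷ P⇒Qs) with P? x | Q? x
  ... | yes px | yes _  = s≤s (length-filter-mono P⇒Qs)
  ... | yes px | no ¬qx = ⊥-elim (¬qx (P⇒Q px))
  ... | no _   | yes _  = m≤n⇒m≤1+n (length-filter-mono P⇒Qs)
  ... | no _   | no _   = length-filter-mono P⇒Qs

module _ {a p} {A : Set a} {P : Pred A p} (P? : Decidable P) where

  length-filter+length-filter-∁ : ∀ xs → length (filter P? xs) + length (filter (∁? P?) xs) ≡ length xs
  length-filter+length-filter-∁ []       = refl
  length-filter+length-filter-∁ (x ∷ xs) with P? x
  ... | yes _ = cong suc (length-filter+length-filter-∁ xs)
  ... | no  _ = trans (+-suc _ _) (cong suc (length-filter+length-filter-∁ xs))

module _ {a r} {A : Set a} {R : Rel A r} where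

  AllPairs-++⁻-across : ∀ {xs ys} → AllPairs R (xs ++ ys) → ∀ {x y} → x ∈ xs → y ∈ ys → R x y
  AllPairs-++⁻-across {_ ∷ xs} (Rxs ∷ _)   (here refl) y∈ys = All.lookup Rxs (∈-++⁺ʳ xs y∈ys)
  AllPairs-++⁻-across {_ ∷ xs} (_ ∷ pairs) (there x∈xs) y∈ys = AllPairs-++⁻-across pairs x∈xs y∈ys

  AllPairs-++⁻ʳ : ∀ xs {ys} → AllPairs R (xs ++ ys) → AllPairs R ys
  AllPairs-++⁻ʳ []       pairs       = pairs
  AllPairs-++⁻ʳ (x ∷ xs) (_ ∷ pairs) = AllPairs-++⁻ʳ xs pairs

module _ {a b} {A : Set a} {B : Set b} (f : A → B) where

  AllPairs-≢-on⇒injective : ∀ {xs} → AllPairs (λ x y → f x ≢ f y) xs →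
                             ∀ {x y} → x ∈ xs → y ∈ xs → f x ≡ f y → x ≡ y
  AllPairs-≢-on⇒injective (_ ∷ _)     (here refl)  (here refl)  _  = refl
  AllPairs-≢-on⇒injective (fx≢ ∷ _)   (here refl)  (there y∈xs) eq = ⊥-elim (All.lookup fx≢ y∈xs eq)
  AllPairs-≢-on⇒injective (fy≢ ∷ _)   (there x∈xs) (here refl)  eq = ⊥-elim (All.lookup fy≢ x∈xs (sym eq))
  AllPairs-≢-on⇒injective (_ ∷ pairs) (there x∈xs) (there y∈xs) eq =
    AllPairs-≢-on⇒injective pairs x∈xs y∈xs eq

-- Reachability

Closed : ∀ {n r} → Rel (Fin n) r → (Fin n → Bool) → Set r
Closed _⟶_ S = ∀ {a b} → S a ≡ true → a ⟶ b → S b ≡ true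

module _ {n r} {_⟶_ : Rel (Fin n) r} (_⟶?_ : Decidable₂ _⟶_) where

  private
    closure : ∀ s (R : Subset n) → Acc _⊃_ R → s ∈ˢ R → (∀ {v} → v ∈ˢ R → Star _⟶_ s v) →
              Σ[ S ∈ (Fin n → Bool) ] (S s ≡ true × (∀ {v} → S v ≡ true → Star _⟶_ s v) × Closed _⟶_ S)
    closure s R (acc larger) s∈R reach
      with any? (λ a → any? (λ b → (a ∈ˢ? R) ×-dec (¬? (b ∈ˢ? R)) ×-dec (a ⟶? b)))
    ... | no noExit = lookup R , []=⇒lookup s∈R , (λ Sv → reach (lookup⇒[]= _ R Sv)) , closed
      where
      closed : Closed _⟶_ (lookup R)
      closed {a} {b} Sa a⟶b with b ∈ˢ? R
      ... | yes b∈R = []=⇒lookup b∈R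
      ... | no  b∉R = ⊥-elim (noExit (a , b , lookup⇒[]= a R Sa , b∉R , a⟶b))
    ... | yes (a , b , a∈R , b∉R , a⟶b) =
      closure s (R ∪ ⁅ b ⁆) (larger R⊂R∪b) (p⊆p∪q ⁅ b ⁆ s∈R) reach′
      where
      R⊂R∪b : R ⊂ R ∪ ⁅ b ⁆
      R⊂R∪b = p⊆p∪q ⁅ b ⁆ , b , x∈p∪q⁺ (inj₂ (x∈⁅x⁆ b)) , b∉R
      reach′ : ∀ {v} → v ∈ˢ R ∪ ⁅ b ⁆ → Star _⟶_ s v
      reach′ v∈R∪b with x∈p∪q⁻ R ⁅ b ⁆ v∈R∪b
      ... | inj₁ v∈R = reach v∈R
      ... | inj₂ v∈b with x∈⁅y⁆⇒x≡y b v∈b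
      ...   | refl = reach a∈R ◅◅ a⟶b ◅ ε

  reachable-or-closed : ∀ s t → Star _⟶_ s t ⊎
                        Σ[ S ∈ (Fin n → Bool) ] (S s ≡ true × S t ≡ false × Closed _⟶_ S)
  reachable-or-closed s t with closure s ⁅ s ⁆ (⊃-wellFounded ⁅ s ⁆) (x∈⁅x⁆ s) s-reaches-⁅s⁆
    where
    s-reaches-⁅s⁆ : ∀ {v} → v ∈ˢ ⁅ s ⁆ → Star _⟶_ s v
    s-reaches-⁅s⁆ v∈⁅s⁆ rewrite x∈⁅y⁆⇒x≡y s v∈⁅s⁆ = ε
  ... | S , Ss , reach , closed with S t in eq
  ... | true  = inj₁ (reach eq)
  ... | false = inj₂ (S , Ss , eq , closed)

module Walks (G : Multigraph) where
  open Multigraph G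
  open import Data.List.Membership.DecPropositional (_≟ᶠ_ {n}) using (_∈?_)

  -- (e , x , y) : the edge e traversed from x to y
  Arc : Set
  Arc = Fin m × Fin n × Fin n

  edge : Arc → Fin m
  edge = proj₁

  source target : Arc → Fin n
  source a = proj₁ (proj₂ a)
  target a = proj₂ (proj₂ a)

  opposite : Arc → Arc
  opposite (e , x , y) = e , y , x

  arcs : ∀ {u v} → Walk G u v → List Arc
  arcs []                   = []
  arcs (step {u} {w} e _ W) = (e , u , w) ∷ arcs W

  infixr 5 _++ʷ_
  _++ʷ_ : ∀ {u w v} → Walk G u w → Walk G w v → Walk G u v
  []         ++ʷ W′ = W′
  step e j W ++ʷ W′ = step e j (W ++ʷ W′)

  arcs-++ʷ : ∀ {u w v} (W : Walk G u w) (W′ : Walk G w v) → arcs (W ++ʷ W′) ≡ arcs W ++ arcs W′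
  arcs-++ʷ []           W′ = refl
  arcs-++ʷ (step e j W) W′ = cong (_ ∷_) (arcs-++ʷ W W′)

  edges≡map-edge-arcs : ∀ {u v} (W : Walk G u v) → edges G W ≡ map edge (arcs W)
  edges≡map-edge-arcs []           = refl
  edges≡map-edge-arcs (step e j W) = cong (e ∷_) (edges≡map-edge-arcs W)

  ∈arcs⇒∈edges : ∀ {u v} (W : Walk G u v) {a} → a ∈ arcs W → edge a ∈ edges G W
  ∈arcs⇒∈edges W a∈W rewrite edges≡map-edge-arcs W = ∈-map⁺ edge a∈W

  ∈edges⇒∈arcs : ∀ {u v} (W : Walk G u v) {e} → e ∈ edges G W → Σ[ a ∈ Arc ] (a ∈ arcs W × edge a ≡ e)
  ∈edges⇒∈arcs W e∈W rewrite edges≡map-edge-arcs W with ∈-map⁻ edge e∈W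
  ... | a , a∈W , refl = a , a∈W , refl

  ∈arcs⇒Joins : ∀ {u v} (W : Walk G u v) {a} → a ∈ arcs W → Joins G (edge a) (source a) (target a)
  ∈arcs⇒Joins (step e j W) (here refl) = j
  ∈arcs⇒Joins (step e j W) (there a∈W) = ∈arcs⇒Joins W a∈W

  head∈verts : ∀ {u v} (W : Walk G u v) → u ∈ verts G W
  head∈verts []           = here refl
  head∈verts (step e j W) = here refl

  ∈arcs⇒∈verts : ∀ {u v} (W : Walk G u v) {a} → a ∈ arcs W → source a ∈ verts G W × target a ∈ verts G W
  ∈arcs⇒∈verts (step e j W) (here refl) = here refl , there (head∈verts W)
  ∈arcs⇒∈verts (step e j W) (there a∈W) with ∈arcs⇒∈verts W a∈W
  ... | x∈W , y∈W = there x∈W , there y∈W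

  Joins-sym : ∀ {e x y} → Joins G e x y → Joins G e y x
  Joins-sym (inj₁ p) = inj₂ p
  Joins-sym (inj₂ p) = inj₁ p

  Joins⇒endpoint : ∀ {e u w x y} → Joins G e u w → Joins G e x y → u ≡ x ⊎ u ≡ y
  Joins⇒endpoint (inj₁ p) (inj₁ q) = inj₁ (,-injectiveˡ (trans (sym p) q))
  Joins⇒endpoint (inj₁ p) (inj₂ q) = inj₂ (,-injectiveˡ (trans (sym p) q))
  Joins⇒endpoint (inj₂ p) (inj₁ q) = inj₂ (,-injectiveʳ (trans (sym p) q))
  Joins⇒endpoint (inj₂ p) (inj₂ q) = inj₁ (,-injectiveʳ (trans (sym p) q))

  DistinctEdges : List Arc → Set
  DistinctEdges = AllPairs (λ a b → edge a ≢ edge b)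

  IsPath⇒DistinctEdges : ∀ {u v} (W : Walk G u v) → IsPath G W → DistinctEdges (arcs W)
  IsPath⇒DistinctEdges []                 _              = []
  IsPath⇒DistinctEdges (step {u} e j W) (u∉W ∷ isPath) =
    All.tabulate e-unused ∷ IsPath⇒DistinctEdges W isPath
    where
    -- otherwise u, an end of e, would occur again later on the path
    e-unused : ∀ {a} → a ∈ arcs W → e ≢ edge a
    e-unused a∈W refl with ∈arcs⇒∈verts W a∈W | Joins⇒endpoint j (∈arcs⇒Joins W a∈W)
    ... | x∈W , _ | inj₁ refl = All.lookup u∉W x∈W refl
    ... | _ , y∈W | inj₂ refl = All.lookup u∉W y∈W refl

  suffixFrom : ∀ {u v} (W : Walk G u v) → IsPath G W → ∀ {x} → x ∈ verts G W →
               Σ[ P ∈ Path G x v ] arcs (walk P) ⊆ arcs W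
  suffixFrom []           isPath      (here refl) = path [] isPath , ⊆-refl
  suffixFrom (step e j W) isPath      (here refl) = path (step e j W) isPath , ⊆-refl
  suffixFrom (step e j W) (_ ∷ isPath) (there x∈W) with suffixFrom W isPath x∈W
  ... | P , P⊆W = P , _ ∷ʳ P⊆W

  shortcut : ∀ {u v} (W : Walk G u v) → Σ[ P ∈ Path G u v ] arcs (walk P) ⊆ arcs W
  shortcut []                 = path [] ([] ∷ []) , []
  shortcut (step {u} e j W) with shortcut W
  ... | P , P⊆W with u ∈? verts G (walk P)
  ...   | yes u∈P = let (P′ , P′⊆P) = suffixFrom (walk P) (isPath P) u∈P in P′ , _ ∷ʳ ⊆-trans P′⊆P P⊆W
  ...   | no  u∉P = path (step e j (walk P)) (¬Any⇒All¬ _ u∉P ∷ isPath P) , refl ∷ P⊆W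

  record _SplitsAt_ {u v} (W : Walk G u v) (a : Arc) : Set where
    field
      before : Walk G u (source a)
      after  : Walk G (target a) v
      arcs≡  : arcs W ≡ arcs before ++ a ∷ arcs after

  splitAt : ∀ {u v} (W : Walk G u v) {a} → a ∈ arcs W → W SplitsAt a
  splitAt (step e j W) (here refl) = record { before = [] ; after = W ; arcs≡ = refl }
  splitAt (step e j W) (there a∈W) =
    record { before = step e j before ; after = after ; arcs≡ = cong (_ ∷_) arcs≡ }
    where open _SplitsAt_ (splitAt W a∈W)

  firstFailure : ∀ {p} {P : Pred Arc p} (P? : Decidable P) {u v} (W : Walk G u v) →
                 All P (arcs W) ⊎ Σ[ a ∈ Arc ] Σ[ d ∈ W SplitsAt a ] (All P (arcs (_SplitsAt_.before d)) × ¬ P a)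
  firstFailure P? [] = inj₁ []
  firstFailure P? (step {u} {w} e j W) with P? (e , u , w)
  ... | no ¬Pa = inj₂ (_ , record { before = [] ; after = W ; arcs≡ = refl } , [] , ¬Pa)
  ... | yes Pa with firstFailure P? W
  ...   | inj₁ all = inj₁ (Pa ∷ all)
  ...   | inj₂ (a , d , Pbefore , ¬Pa) =
    inj₂ (a , record { before = step e j before ; after = after ; arcs≡ = cong (_ ∷_) arcs≡ }
            , Pa ∷ Pbefore , ¬Pa)
    where open _SplitsAt_ d

xor≡true⇒≢ : ∀ {a b} → a xor b ≡ true → a ≢ b
xor≡true⇒≢ {false} {true} _ ()
xor≡true⇒≢ {true} {false} _ ()

≢⇒xor≡true : ∀ {a b} → a ≢ b → a xor b ≡ true
≢⇒xor≡true {false} {false} a≢b = ⊥-elim (a≢b refl)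
≢⇒xor≡true {false} {true}  _   = refl
≢⇒xor≡true {true}  {false} _   = refl
≢⇒xor≡true {true}  {true}  a≢b = ⊥-elim (a≢b refl)

module Cuts (G : Multigraph) where
  open Multigraph G
  open Walks G

  ∂ : (Fin n → Bool) → Subset m
  ∂ S = tabulate λ e → S (proj₁ (ends e)) xor S (proj₂ (ends e))

  module _ (S : Fin n → Bool) where

    ∈∂⇔ends-differ : ∀ {e} → e ∈ˢ ∂ S ⇔ (S (proj₁ (ends e)) ≢ S (proj₂ (ends e)))
    ∈∂⇔ends-differ {e} = mk⇔
      (λ e∈∂ → xor≡true⇒≢ (trans (sym (lookup∘tabulate _ e)) ([]=⇒lookup e∈∂)))
      (λ ends-differ → lookup⇒[]= e (∂ S) (trans (lookup∘tabulate _ e) (≢⇒xor≡true ends-differ)))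

    Joins⇒∈∂ : ∀ {e x y} → Joins G e x y → S x ≢ S y → e ∈ˢ ∂ S
    Joins⇒∈∂ (inj₁ refl) Sx≢Sy = Equivalence.from ∈∂⇔ends-differ Sx≢Sy
    Joins⇒∈∂ (inj₂ refl) Sx≢Sy = Equivalence.from ∈∂⇔ends-differ (Sx≢Sy ∘ sym)

    ∈∂⇒≢ : ∀ {e x y} → Joins G e x y → e ∈ˢ ∂ S → S x ≢ S y
    ∈∂⇒≢ (inj₁ refl) e∈∂ = Equivalence.to ∈∂⇔ends-differ e∈∂
    ∈∂⇒≢ (inj₂ refl) e∈∂ = Equivalence.to ∈∂⇔ends-differ e∈∂ ∘ sym

    crossing-arc : ∀ {x y} (W : Walk G x y) → S x ≢ S y →
                   Σ[ a ∈ Arc ] (a ∈ arcs W × S (source a) ≢ S (target a))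
    crossing-arc []                   Sx≢Sy = ⊥-elim (Sx≢Sy refl)
    crossing-arc (step {u} {w} e j W) Su≢Sv with S u ≟ᵇ S w
    ... | no  Su≢Sw = _ , here refl , Su≢Sw
    ... | yes Su≡Sw with crossing-arc W (λ Sw≡Sv → Su≢Sv (trans Su≡Sw Sw≡Sv))
    ...   | a , a∈W , crosses = a , there a∈W , crosses

    crossing-edge : ∀ {x y} (W : Walk G x y) → S x ≢ S y → Σ[ e ∈ Fin m ] (e ∈ edges G W × e ∈ˢ ∂ S)
    crossing-edge W Sx≢Sy with crossing-arc W Sx≢Sy
    ... | a , a∈W , crosses = edge a , ∈arcs⇒∈edges W a∈W , Joins⇒∈∂ (∈arcs⇒Joins W a∈W) crosses

    -- k edge-disjoint paths cross ∂ S in k distinct edges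
    ∼⇒same-side : ∀ {k x y} → _∼[_]_ G x k y → ∣ ∂ S ∣ < k → S x ≡ S y
    ∼⇒same-side (inj₁ refl) _ = refl
    ∼⇒same-side {k} {x} {y} (inj₂ (P , disjoint)) ∣∂S∣<k with S x ≟ᵇ S y
    ... | yes Sx≡Sy = Sx≡Sy
    ... | no  Sx≢Sy =
      ⊥-elim (<⇒≱ ∣∂S∣<k (injective-into⇒≤∣p∣ (∂ S) cut-edge cut-edge-injective cut-edge-∈∂))
      where
      cut-edge : Fin k → Fin m
      cut-edge i = proj₁ (crossing-edge (walk (P i)) Sx≢Sy)
      cut-edge-on-path : ∀ i → cut-edge i ∈ edges G (walk (P i))
      cut-edge-on-path i = proj₁ (proj₂ (crossing-edge (walk (P i)) Sx≢Sy))
      cut-edge-∈∂ : ∀ i → cut-edge i ∈ˢ ∂ S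
      cut-edge-∈∂ i = proj₂ (proj₂ (crossing-edge (walk (P i)) Sx≢Sy))
      cut-edge-injective : ∀ {i l} → cut-edge i ≡ cut-edge l → i ≡ l
      cut-edge-injective {i} {l} eq with i ≟ᶠ l
      ... | yes i≡l = i≡l
      ... | no  i≢l = ⊥-elim (disjoint i l i≢l _ (cut-edge-on-path i)
                                (subst (_∈ edges G (walk (P l))) (sym eq) (cut-edge-on-path l)))

    Leaves : Arc → Set
    Leaves a = S (source a) ≡ true × S (target a) ≡ false

    NeverEnters : List Arc → Set
    NeverEnters = All (λ a → S (target a) ≡ true → S (source a) ≡ true)

    stays-outside : ∀ {u v} (W : Walk G u v) → S u ≡ false → NeverEnters (arcs W) →
                    All (λ a → S (source a) ≡ false) (arcs W)
    stays-outside []                   _    _                = []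
    stays-outside (step {w = w} e j W) Su≡f (never ∷ nevers) with S w in Sw
    ... | false = Su≡f ∷ stays-outside W Sw nevers
    ... | true  with () ← trans (sym (never refl)) Su≡f

    leaves-once : ∀ {u v} (W : Walk G u v) → NeverEnters (arcs W) →
                  ∀ {a b} → a ∈ arcs W → b ∈ arcs W → Leaves a → Leaves b → a ≡ b
    leaves-once (step e j W) _                (here refl)  (here refl)  _            _            = refl
    leaves-once (step e j W) (_ ∷ nevers)     (here refl)  (there b∈W)  (_ , Sw≡f)   (Sb≡t , _)   =
      case trans (sym Sb≡t) (All.lookup (stays-outside W Sw≡f nevers) b∈W) of λ ()
    leaves-once (step e j W) (_ ∷ nevers)     (there a∈W)  (here refl)  (Sa≡t , _)   (_ , Sw≡f)   =
      case trans (sym Sa≡t) (All.lookup (stays-outside W Sw≡f nevers) a∈W) of λ ()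
    leaves-once (step e j W) (_ ∷ nevers)     (there a∈W)  (there b∈W)  leaves-a     leaves-b     =
      leaves-once W nevers a∈W b∈W leaves-a leaves-b

    crossing⇒Leaves : ∀ {as a} → NeverEnters as → a ∈ as → S (source a) ≢ S (target a) → Leaves a
    crossing⇒Leaves {a = a} nevers a∈as crosses with S (source a) | S (target a) | All.lookup nevers a∈as
    ... | true  | false | _     = refl , refl
    ... | false | true  | never with () ← never refl
    ... | false | false | _     = ⊥-elim (crosses refl)
    ... | true  | true  | _     = ⊥-elim (crosses refl)

module Menger (G : Multigraph) (s t : Fin (Multigraph.n G)) where
  open Multigraph G
  open Walks G
  open Cuts G
  open _SplitsAt_
  open import Data.List.Membership.DecPropositional (_≟ᶠ_ {m}) using () renaming (_∈?_ to _∈ᵉ?_)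

  _≟ᵃ_ : DecidableEquality Arc
  _≟ᵃ_ = ≡-dec _≟ᶠ_ (≡-dec _≟ᶠ_ _≟ᶠ_)

  open import Data.List.Membership.DecPropositional _≟ᵃ_ using () renaming (_∈?_ to _∈ᵃ?_)

  joins? : ∀ e x y → Dec (Joins G e x y)
  joins? e x y = ≡-dec _≟ᶠ_ _≟ᶠ_ (ends e) (x , y) ⊎-dec ≡-dec _≟ᶠ_ _≟ᶠ_ (ends e) (y , x)

  PathSystem : ℕ → Set
  PathSystem j = Fin j → Path G s t

  Disjoint : ∀ {j} → PathSystem j → Set
  Disjoint P = ∀ i l → i ≢ l → ∀ e → e ∈ edges G (walk (P i)) → ¬ e ∈ edges G (walk (P l))

  Free : ∀ {j} → PathSystem j → Fin m → Set
  Free P e = ∀ l → e ∉ edges G (walk (P l))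

  free? : ∀ {j} (P : PathSystem j) → Decidable (Free P)
  free? P e = all? λ l → ¬? (e ∈ᵉ? edges G (walk (P l)))

  Residual : ∀ {j} → PathSystem j → Arc → Set
  Residual {j} P a = Free P (edge a) ⊎ Σ[ l ∈ Fin j ] (opposite a ∈ arcs (walk (P l)))

  residual? : ∀ {j} (P : PathSystem j) → Decidable (Residual P)
  residual? P a = free? P (edge a) ⊎-dec any? λ l → opposite a ∈ᵃ? arcs (walk (P l))

  #used : ∀ {j} → PathSystem j → List Arc → ℕ
  #used P as = length (filter (∁? (free? P ∘ edge)) as)

  #used-++ : ∀ {j} (P : PathSystem j) xs ys → #used P (xs ++ ys) ≡ #used P xs + #used P ys
  #used-++ P xs ys = trans (cong length (filter-++ (∁? (free? P ∘ edge)) xs ys)) (length-++ (filter _ xs))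

  #used-mono : ∀ {j} (P : PathSystem j) {xs ys} → xs ⊆ ys → #used P xs ≤ #used P ys
  #used-mono P xs⊆ys =
    length-mono-≤ (filter⁺ (∁? (free? P ∘ edge)) (∁? (free? P ∘ edge)) (λ { refl → id }) xs⊆ys)

  #used-free : ∀ {j} (P : PathSystem j) {xs} → All (Free P ∘ edge) xs → #used P xs ≡ 0
  #used-free P frees = cong length (filter-none (∁? (free? P ∘ edge)) (All.map (λ free used → used free) frees))

  #used-∷ : ∀ {j} (P : PathSystem j) {a} xs → ¬ Free P (edge a) → #used P (a ∷ xs) ≡ suc (#used P xs)
  #used-∷ P xs used = cong length (filter-accept (∁? (free? P ∘ edge)) used)

  extend : ∀ {j} (P : PathSystem j) → Disjoint P → (R : Path G s t) → All (Free P ∘ edge) (arcs (walk R)) →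
           EdgeDisjointPaths G (suc j) s t
  extend {j} P disjoint R R-free = P⁺ , disjoint⁺
    where
    P⁺ : PathSystem (suc j)
    P⁺ zero    = R
    P⁺ (suc l) = P l
    free-on-R : ∀ {e} → e ∈ edges G (walk R) → Free P e
    free-on-R e∈R with ∈edges⇒∈arcs (walk R) e∈R
    ... | a , a∈R , refl = All.lookup R-free a∈R
    disjoint⁺ : Disjoint P⁺
    disjoint⁺ zero    zero    0≢0 = ⊥-elim (0≢0 refl)
    disjoint⁺ zero    (suc l) _   e e∈R e∈Pl = free-on-R e∈R l e∈Pl
    disjoint⁺ (suc i) zero    _   e e∈Pi e∈R = free-on-R e∈R i e∈Pi
    disjoint⁺ (suc i) (suc l) i≢l = disjoint i l (i≢l ∘ cong suc)

  -- R = R₁ a R₂ is a residual s–t path whose first non-free edge is that of a, so a reverses an arc of some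
  -- P i = Q₁ ā Q₂. Rerouting P i along R₁ Q₂ frees the edges of Q₁, and Q₁ R₂ is a residual path with fewer
  -- non-free edges than R.
  module Exchange {j} (P : PathSystem j) (disjoint : Disjoint P)
                  (R : Path G s t) (R-residual : All (Residual P) (arcs (walk R)))
                  {a} (R-split : walk R SplitsAt a)
                  (R₁-free : All (Free P ∘ edge) (arcs (before R-split)))
                  (a-used : ¬ Free P (edge a)) where

    R₁ : Walk G s (source a)
    R₁ = before R-split

    R₂ : Walk G (target a) t
    R₂ = after R-split

    R₂⊆R : ∀ {b} → b ∈ arcs R₂ → b ∈ arcs (walk R)
    R₂⊆R b∈R₂ = subst (_ ∈_) (sym (arcs≡ R-split)) (∈-++⁺ʳ (arcs R₁) (there b∈R₂))

    R-distinct : DistinctEdges (arcs R₁ ++ a ∷ arcs R₂)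
    R-distinct = subst DistinctEdges (arcs≡ R-split) (IsPath⇒DistinctEdges (walk R) (isPath R))

    a-reversed : Σ[ i ∈ Fin j ] (opposite a ∈ arcs (walk (P i)))
    a-reversed with All.lookup R-residual (subst (a ∈_) (sym (arcs≡ R-split)) (∈-++⁺ʳ (arcs R₁) (here refl)))
    ... | inj₁ free     = ⊥-elim (a-used free)
    ... | inj₂ reversed = reversed

    i : Fin j
    i = proj₁ a-reversed

    Pi-split : walk (P i) SplitsAt opposite a
    Pi-split = splitAt (walk (P i)) (proj₂ a-reversed)

    Q₁ : Walk G s (target a)
    Q₁ = before Pi-split

    Q₂ : Walk G (source a) t
    Q₂ = after Pi-split

    Q₁⊆Pi : ∀ {b} → b ∈ arcs Q₁ → edge b ∈ edges G (walk (P i))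
    Q₁⊆Pi b∈Q₁ = ∈arcs⇒∈edges (walk (P i)) (subst (_ ∈_) (sym (arcs≡ Pi-split)) (∈-++⁺ˡ b∈Q₁))

    Q₂⊆Pi : ∀ {b} → b ∈ arcs Q₂ → edge b ∈ edges G (walk (P i))
    Q₂⊆Pi b∈Q₂ =
      ∈arcs⇒∈edges (walk (P i)) (subst (_ ∈_) (sym (arcs≡ Pi-split)) (∈-++⁺ʳ (arcs Q₁) (there b∈Q₂)))

    Pi-distinct : DistinctEdges (arcs Q₁ ++ opposite a ∷ arcs Q₂)
    Pi-distinct = subst DistinctEdges (arcs≡ Pi-split) (IsPath⇒DistinctEdges (walk (P i)) (isPath (P i)))

    Q₂-distinct : DistinctEdges (arcs Q₂)
    Q₂-distinct with AllPairs-++⁻ʳ (arcs Q₁) Pi-distinct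
    ... | _ ∷ distinct = distinct

    rerouted : Path G s t
    rerouted = proj₁ (shortcut (R₁ ++ʷ Q₂))

    rerouted-arc : ∀ {b} → b ∈ arcs (walk rerouted) → b ∈ arcs R₁ ⊎ b ∈ arcs Q₂
    rerouted-arc b∈ =
      ∈-++⁻ (arcs R₁) (subst (_ ∈_) (arcs-++ʷ R₁ Q₂) (Sublist.lookup (proj₂ (shortcut (R₁ ++ʷ Q₂))) b∈))

    P′ : PathSystem j
    P′ l with l ≟ᶠ i
    ... | yes _ = rerouted
    ... | no  _ = P l

    P′-unchanged : ∀ {l} → l ≢ i → P′ l ≡ P l
    P′-unchanged {l} l≢i with l ≟ᶠ i
    ... | yes l≡i = ⊥-elim (l≢i l≡i)
    ... | no  _   = refl

    P′-rerouted : P′ i ≡ rerouted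
    P′-rerouted with i ≟ᶠ i
    ... | yes _   = refl
    ... | no  i≢i = ⊥-elim (i≢i refl)

    P′-edge : ∀ l {e} → e ∈ edges G (walk (P′ l)) →
              (l ≡ i × e ∈ edges G (walk rerouted)) ⊎ (l ≢ i × e ∈ edges G (walk (P l)))
    P′-edge l e∈ with l ≟ᶠ i
    ... | yes l≡i = inj₁ (l≡i , e∈)
    ... | no  l≢i = inj₂ (l≢i , e∈)

    rerouted-edge : ∀ {e} → e ∈ edges G (walk rerouted) → Free P e ⊎ e ∈ edges G (walk (P i))
    rerouted-edge e∈ with ∈edges⇒∈arcs (walk rerouted) e∈
    ... | b , b∈ , refl with rerouted-arc b∈
    ...   | inj₁ b∈R₁ = inj₁ (All.lookup R₁-free b∈R₁)
    ...   | inj₂ b∈Q₂ = inj₂ (Q₂⊆Pi b∈Q₂)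

    P′-disjoint : Disjoint P′
    P′-disjoint l l′ l≢l′ e e∈l e∈l′ with P′-edge l e∈l | P′-edge l′ e∈l′
    ... | inj₁ (refl , _)   | inj₁ (refl , _)    = l≢l′ refl
    ... | inj₂ (_ , e∈Pl)   | inj₂ (_ , e∈Pl′)   = disjoint l l′ l≢l′ e e∈Pl e∈Pl′
    ... | inj₁ (refl , e∈r) | inj₂ (_ , e∈Pl′) with rerouted-edge e∈r
    ...   | inj₁ free = free l′ e∈Pl′
    ...   | inj₂ e∈Pi = disjoint i l′ l≢l′ e e∈Pi e∈Pl′
    P′-disjoint l l′ l≢l′ e e∈l e∈l′ | inj₂ (_ , e∈Pl) | inj₁ (refl , e∈r) with rerouted-edge e∈r
    ...   | inj₁ free = free l e∈Pl
    ...   | inj₂ e∈Pi = disjoint l i l≢l′ e e∈Pl e∈Pi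

    freed : ∀ {e} → e ∈ edges G (walk (P i)) → e ∉ edges G (walk rerouted) → Free P′ e
    freed e∈Pi e∉r l e∈l with P′-edge l e∈l
    ... | inj₁ (refl , e∈r)   = e∉r e∈r
    ... | inj₂ (l≢i , e∈Pl)   = disjoint i l (l≢i ∘ sym) _ e∈Pi e∈Pl

    R₁-avoids-Pi : ∀ {b e} → b ∈ arcs R₁ → e ∈ edges G (walk (P i)) → edge b ≢ e
    R₁-avoids-Pi b∈R₁ e∈Pi refl = All.lookup R₁-free b∈R₁ i e∈Pi

    Q₁-free : ∀ {b} → b ∈ arcs Q₁ → Free P′ (edge b)
    Q₁-free b∈Q₁ = freed (Q₁⊆Pi b∈Q₁) off-rerouted
      where
      off-rerouted : _ ∉ edges G (walk rerouted)
      off-rerouted e∈ with ∈edges⇒∈arcs (walk rerouted) e∈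
      ... | c , c∈ , c≡b with rerouted-arc c∈
      ...   | inj₁ c∈R₁ = R₁-avoids-Pi c∈R₁ (Q₁⊆Pi b∈Q₁) c≡b
      ...   | inj₂ c∈Q₂ = AllPairs-++⁻-across Pi-distinct b∈Q₁ (there c∈Q₂) (sym c≡b)

    R₂-free : ∀ {b} → b ∈ arcs R₂ → Free P (edge b) → Free P′ (edge b)
    R₂-free b∈R₂ free l e∈l with P′-edge l e∈l
    ... | inj₂ (_ , e∈Pl) = free l e∈Pl
    ... | inj₁ (refl , e∈r) with ∈edges⇒∈arcs (walk rerouted) e∈r
    ...   | c , c∈ , c≡b with rerouted-arc c∈
    ...     | inj₁ c∈R₁ = AllPairs-++⁻-across R-distinct c∈R₁ (there b∈R₂) c≡b
    ...     | inj₂ c∈Q₂ = free i (subst (_∈ edges G (walk (P i))) c≡b (Q₂⊆Pi c∈Q₂))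

    R₂-residual : ∀ {b} → b ∈ arcs R₂ → Residual P b → Residual P′ b
    R₂-residual b∈R₂ (inj₁ free) = inj₁ (R₂-free b∈R₂ free)
    R₂-residual {b} b∈R₂ (inj₂ (l , b̄∈Pl)) with l ≟ᶠ i
    ... | no l≢i = inj₂ (l , subst (λ Q → opposite b ∈ arcs (walk Q)) (sym (P′-unchanged l≢i)) b̄∈Pl)
    ... | yes refl with ∈-++⁻ (arcs Q₁) (subst (_ ∈_) (arcs≡ Pi-split) b̄∈Pl)
    ...   | inj₁ b̄∈Q₁         = inj₁ (Q₁-free b̄∈Q₁)
    ...   | inj₂ (here b̄≡ā)   with AllPairs-++⁻ʳ (arcs R₁) R-distinct
    ...     | a-distinct ∷ _   = ⊥-elim (All.lookup a-distinct b∈R₂ (cong edge (sym b̄≡ā)))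
    R₂-residual {b} b∈R₂ (inj₂ (l , b̄∈Pl)) | yes refl | inj₂ (there b̄∈Q₂)
      with opposite b ∈ᵃ? arcs (walk rerouted)
    ...   | yes b̄∈r = inj₂ (i , subst (λ Q → opposite b ∈ arcs (walk Q)) (sym P′-rerouted) b̄∈r)
    ...   | no  b̄∉r = inj₁ (freed (Q₂⊆Pi b̄∈Q₂) off-rerouted)
      where
      off-rerouted : edge b ∉ edges G (walk rerouted)
      off-rerouted e∈ with ∈edges⇒∈arcs (walk rerouted) e∈
      ... | c , c∈ , c≡b with rerouted-arc c∈
      ...   | inj₁ c∈R₁ = R₁-avoids-Pi c∈R₁ (Q₂⊆Pi b̄∈Q₂) c≡b
      ...   | inj₂ c∈Q₂ with AllPairs-≢-on⇒injective edge Q₂-distinct c∈Q₂ b̄∈Q₂ c≡b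
      ...     | refl = b̄∉r c∈

    N : Path G s t
    N = proj₁ (shortcut (Q₁ ++ʷ R₂))

    N⊆Q₁R₂ : arcs (walk N) ⊆ arcs Q₁ ++ arcs R₂
    N⊆Q₁R₂ = subst (arcs (walk N) ⊆_) (arcs-++ʷ Q₁ R₂) (proj₂ (shortcut (Q₁ ++ʷ R₂)))

    N-residual : All (Residual P′) (arcs (walk N))
    N-residual = All-resp-⊆ N⊆Q₁R₂ (++⁺ (All.tabulate (inj₁ ∘ Q₁-free)) (All.tabulate λ b∈R₂ →
                                        R₂-residual b∈R₂ (All.lookup R-residual (R₂⊆R b∈R₂))))

    #used-R : #used P (arcs (walk R)) ≡ suc (#used P (arcs R₂))
    #used-R = begin
      #used P (arcs (walk R))                   ≡⟨ cong (#used P) (arcs≡ R-split) ⟩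
      #used P (arcs R₁ ++ a ∷ arcs R₂)          ≡⟨ #used-++ P (arcs R₁) (a ∷ arcs R₂) ⟩
      #used P (arcs R₁) + #used P (a ∷ arcs R₂) ≡⟨ cong₂ _+_ (#used-free P R₁-free) (#used-∷ P (arcs R₂) a-used) ⟩
      suc (#used P (arcs R₂))                   ∎
      where open ≡-Reasoning

    N-fewer-used : #used P′ (arcs (walk N)) < #used P (arcs (walk R))
    N-fewer-used = begin-strict
      #used P′ (arcs (walk N))                ≤⟨ #used-mono P′ N⊆Q₁R₂ ⟩
      #used P′ (arcs Q₁ ++ arcs R₂)           ≡⟨ #used-++ P′ (arcs Q₁) (arcs R₂) ⟩
      #used P′ (arcs Q₁) + #used P′ (arcs R₂) ≡⟨ cong (_+ #used P′ (arcs R₂)) (#used-free P′ (All.tabulate Q₁-free)) ⟩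
      #used P′ (arcs R₂)                      ≤⟨ length-filter-mono (∁? (free? P′ ∘ edge)) (∁? (free? P ∘ edge))
                                                   (All.tabulate λ b∈R₂ used′ free → used′ (R₂-free b∈R₂ free)) ⟩
      #used P (arcs R₂)                       <⟨ n<1+n _ ⟩
      suc (#used P (arcs R₂))                 ≡⟨ #used-R ⟨
      #used P (arcs (walk R))                 ∎
      where open ≤-Reasoning

  augment : ∀ {j} c (P : PathSystem j) → Disjoint P → (R : Path G s t) → All (Residual P) (arcs (walk R)) →
            #used P (arcs (walk R)) ≤ c → EdgeDisjointPaths G (suc j) s t
  augment c P disjoint R R-residual bound with firstFailure (free? P ∘ edge) (walk R)
  ... | inj₁ R-free = extend P disjoint R R-free
  ... | inj₂ (a , R-split , R₁-free , a-used) = continue c bound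
    where
    open Exchange P disjoint R R-residual R-split R₁-free a-used
    continue : ∀ c → #used P (arcs (walk R)) ≤ c → EdgeDisjointPaths G (suc _) s t
    continue zero    bound = ⊥-elim (n≮0 (<-≤-trans N-fewer-used bound))
    continue (suc c) bound = augment c P′ P′-disjoint N N-residual (≤-pred (<-≤-trans N-fewer-used bound))

  ResidualStep : ∀ {j} → PathSystem j → Fin n → Fin n → Set
  ResidualStep P x y = Σ[ e ∈ Fin m ] (Joins G e x y × Residual P (e , x , y))

  residual-step? : ∀ {j} (P : PathSystem j) x y → Dec (ResidualStep P x y)
  residual-step? P x y = any? λ e → joins? e x y ×-dec residual? P (e , x , y)

  residual-walk : ∀ {j} (P : PathSystem j) {x y} → Star (ResidualStep P) x y →
                  Σ[ W ∈ Walk G x y ] All (Residual P) (arcs W)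
  residual-walk P ε = [] , []
  residual-walk P ((e , joins , residual) ◅ steps) with residual-walk P steps
  ... | W , W-residual = step e joins W , residual ∷ W-residual

  -- Every edge leaving a residually closed set S lies on a path of P, and each path leaves S only once.
  closed⇒∣∂∣≤ : ∀ {j} (P : PathSystem j) (S : Fin n → Bool) → Closed (ResidualStep P) S → ∣ ∂ S ∣ ≤ j
  closed⇒∣∂∣≤ {j} P S closed = injective-from⇒∣p∣≤ (∂ S) path-of path-of-injective
    where
    never-enters : ∀ l → NeverEnters S (arcs (walk (P l)))
    never-enters l = All.tabulate λ {b} b∈Pl Sy →
      closed Sy (edge b , Joins-sym (∈arcs⇒Joins (walk (P l)) b∈Pl) , inj₂ (l , b∈Pl))

    free⇒same-side : ∀ {e x y} → Joins G e x y → Free P e → S x ≡ S y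
    free⇒same-side {e} {x} {y} joins free with S x in Sx | S y in Sy
    ... | true  | true  = refl
    ... | false | false = refl
    ... | true  | false = trans (sym (closed Sx (e , joins , inj₁ free))) Sy
    ... | false | true  = trans (sym Sx) (closed Sy (e , Joins-sym joins , inj₁ free))

    on-path : ∀ {e} → e ∈ˢ ∂ S → Σ[ l ∈ Fin j ] (e ∈ edges G (walk (P l)))
    on-path {e} e∈∂ with any? (λ l → e ∈ᵉ? edges G (walk (P l)))
    ... | yes found = found
    ... | no  none  =
      ⊥-elim (∈∂⇒≢ S (inj₁ refl) e∈∂ (free⇒same-side (inj₁ refl) λ l e∈Pl → none (l , e∈Pl)))

    path-of : ∀ {e} → e ∈ˢ ∂ S → Fin j
    path-of e∈∂ = proj₁ (on-path e∈∂)

    leaving-arc : ∀ {e} (e∈∂ : e ∈ˢ ∂ S) →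
                  Σ[ b ∈ Arc ] (b ∈ arcs (walk (P (path-of e∈∂))) × edge b ≡ e × Leaves S b)
    leaving-arc e∈∂ with on-path e∈∂
    ... | l , e∈Pl with ∈edges⇒∈arcs (walk (P l)) e∈Pl
    ...   | b , b∈Pl , refl =
      b , b∈Pl , refl ,
      crossing⇒Leaves S (never-enters l) b∈Pl (∈∂⇒≢ S (∈arcs⇒Joins (walk (P l)) b∈Pl) e∈∂)

    path-of-injective : ∀ {e e′} (e∈∂ : e ∈ˢ ∂ S) (e′∈∂ : e′ ∈ˢ ∂ S) → path-of e∈∂ ≡ path-of e′∈∂ → e ≡ e′
    path-of-injective e∈∂ e′∈∂ same with leaving-arc e∈∂ | leaving-arc e′∈∂
    ... | b , b∈ , refl , leaves | b′ , b′∈ , refl , leaves′ =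
      cong edge (leaves-once S (walk (P (path-of e∈∂))) (never-enters (path-of e∈∂)) b∈
                  (subst (λ l → b′ ∈ arcs (walk (P l))) (sym same) b′∈) leaves leaves′)

  menger : ∀ k → EdgeDisjointPaths G k s t ⊎
                 Σ[ S ∈ (Fin n → Bool) ] (S s ≡ true × S t ≡ false × ∣ ∂ S ∣ < k)
  menger zero = inj₁ ((λ ()) , λ ())
  menger (suc k) with menger k
  ... | inj₂ (S , Ss , St , small) = inj₂ (S , Ss , St , m<n⇒m<1+n small)
  ... | inj₁ (P , disjoint) with reachable-or-closed (residual-step? P) s t
  ...   | inj₂ (S , Ss , St , closed) = inj₂ (S , Ss , St , s≤s (closed⇒∣∂∣≤ P S closed))
  ...   | inj₁ reachable with residual-walk P reachable
  ...     | W , W-residual with shortcut W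
  ...       | R , R⊆W = inj₁ (augment _ P disjoint R (All-resp-⊆ R⊆W W-residual) ≤-refl)

split-cost : ∀ {l₁ l₂ x₁ x₂ d K} → 1 ≤ l₁ → 1 ≤ l₂ →
             x₁ ≤ (l₁ ∸ 1) * K → x₂ ≤ (l₂ ∸ 1) * K → d ≤ K → x₁ + x₂ + d ≤ (l₁ + l₂ ∸ 1) * K
split-cost {suc a} {suc b} {x₁} {x₂} {d} {K} _ _ x₁≤ x₂≤ d≤ = begin
  x₁ + x₂ + d         ≤⟨ +-mono-≤ (+-mono-≤ x₁≤ x₂≤) d≤ ⟩
  a * K + b * K + K   ≡⟨ +-assoc (a * K) (b * K) K ⟩
  a * K + (b * K + K) ≡⟨ cong (a * K +_) (+-comm (b * K) K) ⟩
  a * K + suc b * K   ≡⟨ *-distribʳ-+ K a (suc b) ⟨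
  (a + suc b) * K     ∎
  where open ≤-Reasoning

module Separation (G : Multigraph) {p : ℕ} (k : ℕ)
                  (A : Fin p → Subset (Multigraph.n G)) (c : Fin p → Fin (Multigraph.n G))
                  (distinct-classes : ∀ i j → i ≢ j → ¬ _∼[_]_ G (c i) k (c j))
                  (A-in-class : ∀ i x → x ∈ˢ A i → _∼[_]_ G x k (c i)) where
  open Multigraph G
  open Walks G
  open Cuts G

  Separated : Subset m → Fin p → Fin p → Set
  Separated X i j = ¬ HasABPathIn- G X (A i) (A j)

  Separated-mono : ∀ {X Y i j} → X ⊆ˢ Y → Separated X i j → Separated Y i j
  Separated-mono X⊆Y sep (u , v , P , ends , avoids) =
    sep (u , v , P , ends , All.map (λ e∉Y e∈X → e∉Y (X⊆Y e∈X)) avoids)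

  ∂-separates : ∀ {X i j} (S : Fin n → Bool) → ∣ ∂ S ∣ < k → ∂ S ⊆ˢ X → S (c i) ≢ S (c j) → Separated X i j
  ∂-separates {X} {i} {j} S small ∂S⊆X Sci≢Scj (u , v , P , (u∈Ai , v∈Aj , _) , avoids)
    with crossing-edge S (walk P) Su≢Sv
    where
    Su≢Sv : S u ≢ S v
    Su≢Sv Su≡Sv = Sci≢Scj (trans (sym (∼⇒same-side S (A-in-class i u u∈Ai) small))
                                 (trans Su≡Sv (∼⇒same-side S (A-in-class j v v∈Aj) small)))
  ... | e , e∈P , e∈∂ = All.lookup avoids e∈P (∂S⊆X e∈∂)

  _Separates_ : Subset m → List (Fin p) → Set
  X Separates I = ∀ {i j} → i ∈ I → j ∈ I → i ≢ j → Separated X i j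

  record SeparatingSet (I : List (Fin p)) : Set where
    field
      cut           : Subset m
      cut-size      : ∣ cut ∣ ≤ (length I ∸ 1) * (k ∸ 1)
      cut-separates : cut Separates I

  module _ (S : Fin n → Bool) where

    inside? : Decidable (λ i → S (c i) ≡ true)
    inside? i = S (c i) ≟ᵇ true

    insiders outsiders : List (Fin p) → List (Fin p)
    insiders  = filter inside?
    outsiders = filter (∁? inside?)

    glue : ∀ {I} → ∣ ∂ S ∣ < k → 1 ≤ length (insiders I) → 1 ≤ length (outsiders I) →
           SeparatingSet (insiders I) → SeparatingSet (outsiders I) → SeparatingSet I
    glue {I} small nonempty₁ nonempty₂ part₁ part₂ = record
      { cut = X ; cut-size = size ; cut-separates = separates }
      where
      open SeparatingSet part₁ renaming (cut to X₁; cut-size to size₁; cut-separates to separates₁)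
      open SeparatingSet part₂ renaming (cut to X₂; cut-size to size₂; cut-separates to separates₂)

      X : Subset m
      X = (X₁ ∪ X₂) ∪ ∂ S

      size : ∣ X ∣ ≤ (length I ∸ 1) * (k ∸ 1)
      size = begin
        ∣ (X₁ ∪ X₂) ∪ ∂ S ∣       ≤⟨ ∣p∪q∣≤∣p∣+∣q∣ (X₁ ∪ X₂) (∂ S) ⟩
        ∣ X₁ ∪ X₂ ∣ + ∣ ∂ S ∣      ≤⟨ +-mono-≤ (∣p∪q∣≤∣p∣+∣q∣ X₁ X₂) ≤-refl ⟩
        ∣ X₁ ∣ + ∣ X₂ ∣ + ∣ ∂ S ∣  ≤⟨ split-cost nonempty₁ nonempty₂ size₁ size₂ (suc[m]≤n⇒m≤pred[n] small) ⟩
        (length (insiders I) + length (outsiders I) ∸ 1) * (k ∸ 1)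
                                  ≡⟨ cong (λ l → (l ∸ 1) * (k ∸ 1)) (length-filter+length-filter-∁ inside? I) ⟩
        (length I ∸ 1) * (k ∸ 1)  ∎
        where open ≤-Reasoning

      separates : X Separates I
      separates {i} {j} i∈I j∈I i≢j with S (c i) ≟ᵇ S (c j) | inside? i
      ... | no  Sci≢Scj | _       = ∂-separates S small (q⊆p∪q (X₁ ∪ X₂) (∂ S)) Sci≢Scj
      ... | yes Sci≡Scj | yes Sci = Separated-mono (p⊆p∪q (∂ S) ∘ p⊆p∪q X₂)
        (separates₁ (∈-filter⁺ inside? i∈I Sci) (∈-filter⁺ inside? j∈I (trans (sym Sci≡Scj) Sci)) i≢j)
      ... | yes Sci≡Scj | no ¬Sci = Separated-mono (p⊆p∪q (∂ S) ∘ q⊆p∪q X₁ X₂)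
        (separates₂ (∈-filter⁺ (∁? inside?) i∈I ¬Sci) (∈-filter⁺ (∁? inside?) j∈I (¬Sci ∘ trans Sci≡Scj))
                    i≢j)

  -- Menger's theorem separates two classes by a boundary of fewer than k edges, which no class straddles.
  separate : (I : List (Fin p)) → Unique I → Acc _<_ (length I) → SeparatingSet I
  separate []       _ _ = record { cut = ⊥ ; cut-size = ≤-reflexive (∣⊥∣≡0 m) ; cut-separates = λ () }
  separate (i ∷ []) _ _ = record
    { cut = ⊥ ; cut-size = ≤-reflexive (∣⊥∣≡0 m)
    ; cut-separates = λ { (here refl) (here refl) i≢i → ⊥-elim (i≢i refl) } }
  separate I@(i₀ ∷ i₁ ∷ _) unique@((i₀≢i₁ ∷ _) ∷ _) (acc shorter) with Menger.menger G (c i₀) (c i₁) k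
  ... | inj₁ paths                   = ⊥-elim (distinct-classes i₀ i₁ i₀≢i₁ (inj₂ paths))
  ... | inj₂ (S , Sc₀ , Sc₁ , small) =
    glue S small (filter-some (inside? S) i₀-inside) (filter-some (∁? (inside? S)) i₁-outside)
      (separate (insiders S I) (Unique.filter⁺ (inside? S) unique)
                (shorter (filter-notAll (inside? S) I i₁-outside)))
      (separate (outsiders S I) (Unique.filter⁺ (∁? (inside? S)) unique)
                (shorter (filter-notAll (∁? (inside? S)) I (here λ ¬Sc₀ → ¬Sc₀ Sc₀))))
    where
    i₀-inside : Any (λ i → S (c i) ≡ true) I
    i₀-inside = here Sc₀
    i₁-outside : Any (λ i → ¬ S (c i) ≡ true) I
    i₁-outside = there (here (not-¬ Sc₁))

lemma10 : (k p : ℕ) → 1 ≤ k → 1 ≤ p → (G : Multigraph) →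
    (A : Fin p → Subset (Multigraph.n G)) →
    (c : Fin p → Fin (Multigraph.n G)) →
    (∀ i j → i ≢ j → ¬ (_∼[_]_ G (c i) k (c j))) →
    (∀ i x → x ∈ˢ A i → _∼[_]_ G x k (c i)) →
    Σ[ X ∈ Subset (Multigraph.m G) ]
    (∣ X ∣ ≤ (p ∸ 1) * (k ∸ 1) ×
    (∀ i j → i ≢ j → ¬ HasABPathIn- G X (A i) (A j)))
lemma10 k p _ _ G A c distinct-classes A-in-class =
  cut , subst (λ l → ∣ cut ∣ ≤ (l ∸ 1) * (k ∸ 1)) (length-tabulate {n = p} id) cut-size ,
  λ i j → cut-separates (∈-allFin i) (∈-allFin j)
  where
  open Separation G k A c distinct-classes A-in-class
  open SeparatingSet (separate (allFin p) (Unique.allFin⁺ p) (<-wellFounded _))
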